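{- Let $G=(V,E)$ be a directed graph whose edges are given on the external tape of a RATM-BIO as adjacency lists. Then the worst case external access trace complexity of the DFS-Random Access algorithm on the RATM-BIO is $O(|V||E|)$.
   Context: A RATM-BIO (random access Turing machine with blocking IO) with main memory size $M$ has four tapes: a main memory tape of $M$ cells with its address tape, and an unbounded external memory tape with its address tape; it has a main head with random access on the main memory tape and an external head that moves only one cell at a time on the external tape. Its transitions are partitioned into main memory computation transitions (the main head operates, the external head halts), external memory access transitions (the main head halts, the external head moves), and Read/Write transitions. On entering a Read (Write) state, the main head writes an external address on the external address tape and halts; the external head then moves cell by cell to the designated cell, whose content then replaces (is replaced by) the content of the main memory cell under the main head; then the external head halts and the main head resumes. The external access trace complexity is the total number of moves of the external head. Setting (semi-external): the main memory has size $O(|V|)$ and holds an array $free[\cdot]$ indexed by $V$ and a stack. The DFS-Random Access algorithm: set $free[u]=1$ for every vertex $u$; then for each vertex $u$: push $u$ on an empty stack; while the stack is nonempty, pop a vertex $v$; if $free[v]=1$, set $free[v]=0$ and, reading the adjacency list of $v$ from external memory, push each out-neighbor $w$ of $v$ with $free[w]=1$ onto the stack. The only IO operations are the reads of the adjacency lists. -}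

module Defs where

open import Data.Nat using (ℕ; zero; suc; _+_; ∣_-_∣)
open import Data.Bool using (Bool; true; false; if_then_else_)
open import Data.Fin using (Fin; toℕ; _≟_)
open import Data.Nat.ListAction using (sum)
open import Data.List using (List; []; _∷_; _++_; map; length; take; allFin; upTo)
open import Data.Product using (_×_; _,_)
open import Relation.Nullary.Decidable using (⌊_⌋)

-- A directed graph on vertex set V = Fin n, given by adjacency lists
-- (out-neighbours).  Parallel edges / self-loops are allowed; |E| is the
-- total length of all adjacency lists.
Graph : ℕ → Set
Graph n = Fin n → List (Fin n)

deg : ∀ {n} → Graph n → Fin n → ℕ
deg G v = length (G v)

numEdges : ∀ {n} → Graph n → ℕ
numEdges {n} G = sum (map (deg G) (allFin n))

-- Layout of the graph on the external tape (cells addressed 0,1,2,...):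
-- the adjacency lists are stored consecutively in vertex order; the list
-- of v occupies 1 + deg v cells: a header cell (holding deg v) followed
-- by the entries of G v.

start : ∀ {n} → Graph n → Fin n → ℕ
start {n} G v = sum (map (λ u → suc (deg G u)) (take (toℕ v) (allFin n)))

listAddrs : ∀ {n} → Graph n → Fin n → List ℕ
listAddrs G v = map (λ i → start G v + i) (upTo (suc (deg G v)))

-- External access trace complexity: the external head moves one cell at
-- a time; a Read of address a when the head is at p costs |p - a| moves.

traceCost : ℕ → List ℕ → ℕ
traceCost p [] = 0
traceCost p (a ∷ as) = ∣ p - a ∣ + traceCost a as

-- The DFS-Random Access algorithm.  free[] lives in main memory.

setFree : ∀ {n} → (Fin n → Bool) → Fin n → Bool → (Fin n → Bool)
setFree f v b u = if ⌊ u ≟ v ⌋ then b else f u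

pushFree : ∀ {n} → (Fin n → Bool) → List (Fin n) → List (Fin n) → List (Fin n)
pushFree f [] st = st
pushFree f (w ∷ ws) st = pushFree f ws (if f w then w ∷ st else st)

-- the while-loop, with a fuel parameter k (one unit per pop); the fuel
-- used below is provably sufficient (total number of pushes is at most
-- n + |E|), so it never truncates the execution.
whileLoop : ∀ {n} → Graph n → ℕ → (Fin n → Bool) → List (Fin n) → List ℕ
          → (Fin n → Bool) × List ℕ
whileLoop G zero f st tr = f , tr
whileLoop G (suc k) f [] tr = f , tr
whileLoop G (suc k) f (v ∷ st) tr with f v
... | false = whileLoop G k f st tr
... | true  = whileLoop G k (setFree f v false)
                          (pushFree (setFree f v false) (G v) st)
                          (tr ++ listAddrs G v)

fuel : ∀ {n} → Graph n → ℕ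
fuel {n} G = suc (n + numEdges G)

outerLoop : ∀ {n} → Graph n → List (Fin n) → (Fin n → Bool) → List ℕ → List ℕ
outerLoop G [] f tr = tr
outerLoop G (u ∷ us) f tr with whileLoop G (fuel G) f (u ∷ []) tr
... | f' , tr' = outerLoop G us f' tr'

dfsTrace : ∀ {n} → Graph n → List ℕ
dfsTrace {n} G = outerLoop G (allFin n) (λ _ → true) []

externalCost : ∀ {n} → Graph n → ℕ
externalCost G = traceCost 0 (dfsTrace G)

{-# OPTIONS --safe #-}

-- The tape holds T = |V| + |E| cells and every adjacency list is read at most once.  Call a read
-- an excursion if it happens while processing the stack, and a root read if it is the first read
-- of an outer-loop iteration.  An excursion pops a stack entry, i.e. uses up an edge, so there are
-- at most min(|V|, |E|) of them, and each moves the head O(T) cells.  Root reads happen in tape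
-- order, so between them the head moves forward at most T cells in total, apart from first
-- returning from where the last excursions left it.  Prepaying that return trip, the potential
--   cost + ∣ head - base ∣ ≤ base + 3 T · #excursions,
-- with base the end of the last root list, is invariant; hence the cost is at most
-- T + 3 T min(|V|, |E|) ≤ 8 |V| |E|.

module Submission where

open import Defs
open import Data.Nat using (ℕ; zero; suc; _+_; _*_; _∸_; _≤_; _<_; ∣_-_∣; z≤n; s≤s)
open import Data.Nat.Properties
open import Data.Nat.ListAction using (sum)
open import Data.Nat.Tactic.RingSolver using (solve-∀)
open import Data.Bool using (Bool; true; false; if_then_else_)
open import Data.Fin as Fin using (Fin; toℕ)
open import Data.List using (List; []; _∷_; _++_; _∷ʳ_; [_]; map; length; take; tabulate; allFin; upTo)
open import Data.List.Properties
  using (map-tabulate; take-map; take-all; length-tabulate; tabulate-cong; upTo-∷ʳ; map-++)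
open import Data.List.Relation.Unary.All as All using (All; _∷_)
open import Data.List.Relation.Unary.AllPairs using (AllPairs; _∷_)
open import Data.List.Relation.Unary.AllPairs.Properties using (tabulate⁺-<)
open import Data.Product using (∃-syntax; _×_; _,_; proj₁; proj₂)
open import Data.Sum using (_⊎_; inj₁; inj₂)
open import Function using (id; _∘_)
open import Relation.Binary.PropositionalEquality hiding ([_])
open import Relation.Nullary using (yes; no)
open import Data.Fin.Properties using (toℕ<n)
open import Algebra.Properties.CommutativeSemigroup +-commutativeSemigroup using (x∙yz≈y∙xz)

prefixSum : ∀ {m} → (Fin m → ℕ) → ℕ → ℕ
prefixSum t k = sum (take k (tabulate t))

prefixSum-step≤ : ∀ {m} (t : Fin m → ℕ) (i : Fin m) {k} → toℕ i < k →
                  prefixSum t (toℕ i) + t i ≤ prefixSum t k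
prefixSum-step≤ t Fin.zero {suc k} _ = m≤m+n (t Fin.zero) _
prefixSum-step≤ t (Fin.suc i) {suc k} (s≤s i<k) = begin
  t Fin.zero + prefixSum (t ∘ Fin.suc) (toℕ i) + t (Fin.suc i)
    ≡⟨ +-assoc (t Fin.zero) _ _ ⟩
  t Fin.zero + (prefixSum (t ∘ Fin.suc) (toℕ i) + t (Fin.suc i))
    ≤⟨ +-monoʳ-≤ (t Fin.zero) (prefixSum-step≤ (t ∘ Fin.suc) i i<k) ⟩
  t Fin.zero + prefixSum (t ∘ Fin.suc) k ∎
  where open ≤-Reasoning

prefixSum-all : ∀ {m} (t : Fin m → ℕ) → prefixSum t m ≡ sum (tabulate t)
prefixSum-all {m} t = cong sum (take-all m (tabulate t) (≤-reflexive (length-tabulate t)))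

sum-tabulate-suc : ∀ {m} (t : Fin m → ℕ) → sum (tabulate (suc ∘ t)) ≡ m + sum (tabulate t)
sum-tabulate-suc {zero} t = refl
sum-tabulate-suc {suc m} t =
  cong suc (trans (cong (t Fin.zero +_) (sum-tabulate-suc (t ∘ Fin.suc))) (x∙yz≈y∙xz (t Fin.zero) m _))

visitedSum : ∀ {m} → (Fin m → Bool) → (Fin m → ℕ) → ℕ
visitedSum free t = sum (tabulate (λ w → if free w then 0 else t w))

visitedSum≤sum : ∀ {m} (free : Fin m → Bool) (t : Fin m → ℕ) → visitedSum free t ≤ sum (tabulate t)
visitedSum≤sum {zero} free t = z≤n
visitedSum≤sum {suc m} free t with free Fin.zero
... | true = ≤-trans (visitedSum≤sum (free ∘ Fin.suc) (t ∘ Fin.suc)) (m≤n+m _ (t Fin.zero))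
... | false = +-monoʳ-≤ (t Fin.zero) (visitedSum≤sum (free ∘ Fin.suc) (t ∘ Fin.suc))

visitedCount : ∀ {m} → (Fin m → Bool) → ℕ
visitedCount free = visitedSum free (λ _ → 1)

visitedCount≤ : ∀ {m} (free : Fin m → Bool) → visitedCount free ≤ m
visitedCount≤ {m} free = ≤-trans (visitedSum≤sum free _) (≤-reflexive (sum-tabulate-one m))
  where
  sum-tabulate-one : ∀ m → sum (tabulate {n = m} (λ _ → 1)) ≡ m
  sum-tabulate-one zero = refl
  sum-tabulate-one (suc m) = cong suc (sum-tabulate-one m)

visitedSum-cong : ∀ {m} {free free′ : Fin m → Bool} → (∀ w → free w ≡ free′ w) →
                  (t : Fin m → ℕ) → visitedSum free t ≡ visitedSum free′ t
visitedSum-cong free≗free′ t = cong sum (tabulate-cong (λ w → cong (λ b → if b then 0 else t w) (free≗free′ w)))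

setFree-suc : ∀ {m} (free : Fin (suc m) → Bool) v b w →
              setFree free (Fin.suc v) b (Fin.suc w) ≡ setFree (free ∘ Fin.suc) v b w
setFree-suc free v b w with w Fin.≟ v
... | yes _ = refl
... | no _ = refl

visitedSum-setFree : ∀ {m} (free : Fin m → Bool) (t : Fin m → ℕ) v → free v ≡ true →
                     visitedSum (setFree free v false) t ≡ t v + visitedSum free t
visitedSum-setFree free t Fin.zero free[0] rewrite free[0] = refl
visitedSum-setFree free t (Fin.suc v) free[v] =
  begin
    head + visitedSum (setFree free (Fin.suc v) false ∘ Fin.suc) (t ∘ Fin.suc)
      ≡⟨ cong (head +_) (visitedSum-cong (setFree-suc free v false) (t ∘ Fin.suc)) ⟩
    head + visitedSum (setFree (free ∘ Fin.suc) v false) (t ∘ Fin.suc)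
      ≡⟨ cong (head +_) (visitedSum-setFree (free ∘ Fin.suc) (t ∘ Fin.suc) v free[v]) ⟩
    head + (t (Fin.suc v) + visitedSum (free ∘ Fin.suc) (t ∘ Fin.suc))
      ≡⟨ x∙yz≈y∙xz head (t (Fin.suc v)) _ ⟩
    t (Fin.suc v) + visitedSum free t ∎
  where
  open ≡-Reasoning
  head : ℕ
  head = if free Fin.zero then 0 else t Fin.zero

headAfter : ℕ → List ℕ → ℕ
headAfter p [] = p
headAfter p (a ∷ as) = headAfter a as

headAfter-++ : ∀ p xs ys → headAfter p (xs ++ ys) ≡ headAfter (headAfter p xs) ys
headAfter-++ p [] ys = refl
headAfter-++ p (x ∷ xs) ys = headAfter-++ x xs ys

traceCost-++ : ∀ p xs ys → traceCost p (xs ++ ys) ≡ traceCost p xs + traceCost (headAfter p xs) ys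
traceCost-++ p [] ys = refl
traceCost-++ p (x ∷ xs) ys = trans (cong (∣ p - x ∣ +_) (traceCost-++ x xs ys)) (sym (+-assoc ∣ p - x ∣ _ _))

cellRange : ℕ → ℕ → List ℕ
cellRange s d = map (s +_) (upTo (suc d))

cellRange-∷ʳ : ∀ s d → cellRange s (suc d) ≡ cellRange s d ∷ʳ (s + suc d)
cellRange-∷ʳ s d = trans (cong (map (s +_)) (sym (upTo-∷ʳ (suc d)))) (map-++ (s +_) (upTo (suc d)) [ suc d ])

headAfter-cellRange : ∀ p s d → headAfter p (cellRange s d) ≡ s + d
headAfter-cellRange p s zero = refl
headAfter-cellRange p s (suc d) = trans (cong (headAfter p) (cellRange-∷ʳ s d)) (headAfter-++ p (cellRange s d) _)

∣n-1+n∣≡1 : ∀ n → ∣ n - suc n ∣ ≡ 1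
∣n-1+n∣≡1 zero = refl
∣n-1+n∣≡1 (suc n) = ∣n-1+n∣≡1 n

traceCost-cellRange : ∀ p s d → traceCost p (cellRange s d) ≡ ∣ p - s ∣ + d
traceCost-cellRange p s zero = cong (λ x → ∣ p - x ∣ + 0) (+-identityʳ s)
traceCost-cellRange p s (suc d) = begin
  traceCost p (cellRange s (suc d))
    ≡⟨ cong (traceCost p) (cellRange-∷ʳ s d) ⟩
  traceCost p (cellRange s d ∷ʳ (s + suc d))
    ≡⟨ traceCost-++ p (cellRange s d) _ ⟩
  traceCost p (cellRange s d) + (∣ headAfter p (cellRange s d) - s + suc d ∣ + 0)
    ≡⟨ cong₂ (λ c e → c + (∣ e - s + suc d ∣ + 0)) (traceCost-cellRange p s d) (headAfter-cellRange p s d) ⟩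
  ∣ p - s ∣ + d + (∣ s + d - s + suc d ∣ + 0)
    ≡⟨ cong (λ x → ∣ p - s ∣ + d + (∣ s + d - x ∣ + 0)) (+-suc s d) ⟩
  ∣ p - s ∣ + d + (∣ s + d - suc (s + d) ∣ + 0)
    ≡⟨ cong (λ x → ∣ p - s ∣ + d + (x + 0)) (∣n-1+n∣≡1 (s + d)) ⟩
  ∣ p - s ∣ + d + 1
    ≡⟨ +-assoc ∣ p - s ∣ d 1 ⟩
  ∣ p - s ∣ + (d + 1)
    ≡⟨ cong (∣ p - s ∣ +_) (+-comm d 1) ⟩
  ∣ p - s ∣ + suc d ∎
  where open ≡-Reasoning

∣m-n∣≤o : ∀ {m n o} → m ≤ o → n ≤ o → ∣ m - n ∣ ≤ o
∣m-n∣≤o {m} {n} m≤o n≤o = ≤-trans (∣m-n∣≤m⊔n m n) (⊔-lub m≤o n≤o)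

-- After splitting ∣ p - s ∣ at b, every term except ∣ p - b ∣ (paid by the potential) is at most T.
excursion-cost : ∀ c p s d {b T V} → c + ∣ p - b ∣ ≤ b + 3 * T * V → b ≤ T → s + d ≤ T →
                 c + (∣ p - s ∣ + d) + ∣ s + d - b ∣ ≤ b + 3 * T * suc V
excursion-cost c p s d {b} {T} {V} potential b≤T s+d≤T = begin
  c + (∣ p - s ∣ + d) + ∣ s + d - b ∣
    ≤⟨ +-monoˡ-≤ ∣ s + d - b ∣ (+-monoʳ-≤ c (+-monoˡ-≤ d (∣-∣-triangle p b s))) ⟩
  c + ((∣ p - b ∣ + ∣ b - s ∣) + d) + ∣ s + d - b ∣
    ≤⟨ +-mono-≤ (+-monoʳ-≤ c (+-mono-≤ (+-monoʳ-≤ ∣ p - b ∣ ∣b-s∣≤T) d≤T)) ∣s+d-b∣≤T ⟩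
  c + ((∣ p - b ∣ + T) + T) + T
    ≡⟨ regroup c ∣ p - b ∣ T ⟩
  (c + ∣ p - b ∣) + 3 * T
    ≤⟨ +-monoˡ-≤ (3 * T) potential ⟩
  b + 3 * T * V + 3 * T
    ≡⟨ fold b T V ⟩
  b + 3 * T * suc V ∎
  where
  open ≤-Reasoning
  ∣b-s∣≤T : ∣ b - s ∣ ≤ T
  ∣b-s∣≤T = ∣m-n∣≤o b≤T (m+n≤o⇒m≤o s s+d≤T)
  d≤T : d ≤ T
  d≤T = m+n≤o⇒n≤o s s+d≤T
  ∣s+d-b∣≤T : ∣ s + d - b ∣ ≤ T
  ∣s+d-b∣≤T = ∣m-n∣≤o s+d≤T b≤T
  regroup : ∀ c x T → c + ((x + T) + T) + T ≡ (c + x) + 3 * T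
  regroup = solve-∀
  fold : ∀ b T V → b + 3 * T * V + 3 * T ≡ b + 3 * T * suc V
  fold = solve-∀

-- The forward move s ∸ b is absorbed by raising the base from b to s + d.
rebase-cost : ∀ c p s d {b K} → c + ∣ p - b ∣ ≤ b + K → b ≤ s →
              c + (∣ p - s ∣ + d) + ∣ s + d - (s + d) ∣ ≤ s + d + K
rebase-cost c p s d {b} {K} potential b≤s = begin
  c + (∣ p - s ∣ + d) + ∣ s + d - (s + d) ∣
    ≡⟨ cong (c + (∣ p - s ∣ + d) +_) (∣n-n∣≡0 (s + d)) ⟩
  c + (∣ p - s ∣ + d) + 0
    ≤⟨ +-monoˡ-≤ 0 (+-monoʳ-≤ c (+-monoˡ-≤ d (∣-∣-triangle p b s))) ⟩
  c + ((∣ p - b ∣ + ∣ b - s ∣) + d) + 0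
    ≡⟨ cong (λ x → c + ((∣ p - b ∣ + x) + d) + 0) (m≤n⇒∣m-n∣≡n∸m b≤s) ⟩
  c + ((∣ p - b ∣ + (s ∸ b)) + d) + 0
    ≡⟨ regroup c ∣ p - b ∣ (s ∸ b) d ⟩
  (c + ∣ p - b ∣) + ((s ∸ b) + d)
    ≤⟨ +-monoˡ-≤ _ potential ⟩
  (b + K) + ((s ∸ b) + d)
    ≡⟨ regroup′ b K (s ∸ b) d ⟩
  b + (s ∸ b) + d + K
    ≡⟨ cong (λ x → x + d + K) (m+[n∸m]≡n b≤s) ⟩
  s + d + K ∎
  where
  open ≤-Reasoning
  regroup : ∀ c x y d → c + ((x + y) + d) + 0 ≡ (c + x) + (y + d)
  regroup = solve-∀
  regroup′ : ∀ b K y d → (b + K) + (y + d) ≡ b + y + d + K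
  regroup′ = solve-∀

n+E+3[n+E]V≤8nE : ∀ {n E V} → V ≤ n → V ≤ E → 1 ≤ n → 1 ≤ E → (n + E) + 3 * (n + E) * V ≤ 8 * n * E
n+E+3[n+E]V≤8nE {n} {E} {V} V≤n V≤E 1≤n 1≤E = begin
  (n + E) + 3 * (n + E) * V
    ≡⟨ expand n E V ⟩
  n * 1 + 1 * E + 3 * n * V + 3 * E * V
    ≤⟨ +-mono-≤ (+-mono-≤ (+-mono-≤ (*-monoʳ-≤ n 1≤E) (*-monoˡ-≤ E 1≤n)) (*-monoʳ-≤ (3 * n) V≤E))
                (*-monoʳ-≤ (3 * E) V≤n) ⟩
  n * E + n * E + 3 * n * E + 3 * E * n
    ≡⟨ collect n E ⟩
  8 * n * E ∎
  where
  open ≤-Reasoning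
  expand : ∀ n E V → (n + E) + 3 * (n + E) * V ≡ n * 1 + 1 * E + 3 * n * V + 3 * E * V
  expand = solve-∀
  collect : ∀ n E → n * E + n * E + 3 * n * E + 3 * E * n ≡ 8 * n * E
  collect = solve-∀

length-pushFree : ∀ {n} (free : Fin n → Bool) ws st → length (pushFree free ws st) ≤ length ws + length st
length-pushFree free [] st = ≤-refl
length-pushFree free (w ∷ ws) st with free w
... | true = ≤-trans (length-pushFree free ws (w ∷ st)) (≤-reflexive (+-suc (length ws) (length st)))
... | false = ≤-trans (length-pushFree free ws st) (n≤1+n _)

module DFSCost {n : ℕ} (G : Graph n) where

  tapeSize : ℕ
  tapeSize = sum (tabulate (suc ∘ deg G))

  numEdges≡sum : numEdges G ≡ sum (tabulate (deg G))
  numEdges≡sum = cong sum (map-tabulate id (deg G))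

  tapeSize≡n+numEdges : tapeSize ≡ n + numEdges G
  tapeSize≡n+numEdges = trans (sum-tabulate-suc (deg G)) (cong (n +_) (sym numEdges≡sum))

  listEnd : Fin n → ℕ
  listEnd v = start G v + deg G v

  start≡prefixSum : ∀ v → start G v ≡ prefixSum (suc ∘ deg G) (toℕ v)
  start≡prefixSum v =
    cong sum (trans (sym (take-map (toℕ v) (allFin n))) (cong (take (toℕ v)) (map-tabulate id (suc ∘ deg G))))

  listEnd<prefixSum : ∀ u {k} → toℕ u < k → listEnd u < prefixSum (suc ∘ deg G) k
  listEnd<prefixSum u {k} u<k = begin-strict
    start G u + deg G u                             <⟨ +-monoʳ-< (start G u) ≤-refl ⟩
    start G u + suc (deg G u)                       ≡⟨ cong (_+ suc (deg G u)) (start≡prefixSum u) ⟩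
    prefixSum (suc ∘ deg G) (toℕ u) + suc (deg G u) ≤⟨ prefixSum-step≤ (suc ∘ deg G) u u<k ⟩
    prefixSum (suc ∘ deg G) k                       ∎
    where open ≤-Reasoning hiding (start)

  listEnd≤tapeSize : ∀ u → listEnd u ≤ tapeSize
  listEnd≤tapeSize u =
    ≤-trans (<⇒≤ (listEnd<prefixSum u (toℕ<n u))) (≤-reflexive (prefixSum-all (suc ∘ deg G)))

  listsInOrder : AllPairs (λ u w → listEnd u ≤ start G w) (allFin n)
  listsInOrder = tabulate⁺-< (λ {u} {w} u<w →
    ≤-trans (<⇒≤ (listEnd<prefixSum u u<w)) (≤-reflexive (sym (start≡prefixSum w))))

  cost position : List ℕ → ℕ
  cost = traceCost 0
  position = headAfter 0

  read-cost : ∀ tr v → cost (tr ++ listAddrs G v) ≡ cost tr + (∣ position tr - start G v ∣ + deg G v)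
  read-cost tr v = trans (traceCost-++ 0 tr (listAddrs G v))
                         (cong (cost tr +_) (traceCost-cellRange (position tr) (start G v) (deg G v)))

  read-position : ∀ tr v → position (tr ++ listAddrs G v) ≡ listEnd v
  read-position tr v = trans (headAfter-++ 0 tr (listAddrs G v))
                             (headAfter-cellRange (position tr) (start G v) (deg G v))

  -- base: end of the last root list read (0 before the first one); excursions: number of
  -- adjacency lists read while processing the stack.
  record Invariant (base excursions : ℕ) (free : Fin n → Bool) (stack : List (Fin n)) (trace : List ℕ) : Set where
    field
      base≤tapeSize : base ≤ tapeSize
      cost-bound : cost trace + ∣ position trace - base ∣ ≤ base + 3 * tapeSize * excursions
      pending-bound : excursions + length stack ≤ visitedSum free (deg G)
      excursions-bound : excursions ≤ visitedCount free
  open Invariant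

  invariant-initially : Invariant 0 0 (λ _ → true) [] []
  invariant-initially = record
    { base≤tapeSize = z≤n ; cost-bound = z≤n ; pending-bound = z≤n ; excursions-bound = z≤n }

  shrink-stack : ∀ {b V f st st′ tr} → length st′ ≤ length st → Invariant b V f st tr → Invariant b V f st′ tr
  shrink-stack st′≤st inv = record
    { base≤tapeSize = base≤tapeSize inv
    ; cost-bound = cost-bound inv
    ; pending-bound = ≤-trans (+-monoʳ-≤ _ st′≤st) (pending-bound inv)
    ; excursions-bound = excursions-bound inv
    }

  pending-visit : ∀ {k f st} v → f v ≡ true → k + length st ≤ visitedSum f (deg G) →
                  k + length (pushFree (setFree f v false) (G v) st) ≤ visitedSum (setFree f v false) (deg G)
  pending-visit {k} {f} {st} v fv pending = begin
    k + length (pushFree (setFree f v false) (G v) st) ≤⟨ +-monoʳ-≤ k (length-pushFree _ (G v) st) ⟩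
    k + (deg G v + length st)                          ≡⟨ x∙yz≈y∙xz k (deg G v) _ ⟩
    deg G v + (k + length st)                          ≤⟨ +-monoʳ-≤ (deg G v) pending ⟩
    deg G v + visitedSum f (deg G)                     ≡⟨ sym (visitedSum-setFree f (deg G) v fv) ⟩
    visitedSum (setFree f v false) (deg G)             ∎
    where open ≤-Reasoning hiding (start)

  excursions-visit : ∀ {k} {f : Fin n → Bool} v → f v ≡ true → k ≤ visitedCount f →
                     suc k ≤ visitedCount (setFree f v false)
  excursions-visit {f = f} v fv k≤ = ≤-trans (s≤s k≤) (≤-reflexive (sym (visitedSum-setFree f (λ _ → 1) v fv)))

  visit-excursion : ∀ {b V f st tr v} → f v ≡ true → Invariant b V f (v ∷ st) tr →
                 Invariant b (suc V) (setFree f v false) (pushFree (setFree f v false) (G v) st) (tr ++ listAddrs G v)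
  visit-excursion {b} {V} {f} {st} {tr} {v} fv inv = record
    { base≤tapeSize = base≤tapeSize inv
    ; cost-bound = subst₂ (λ c p → c + ∣ p - b ∣ ≤ b + 3 * tapeSize * suc V)
                          (sym (read-cost tr v)) (sym (read-position tr v))
                          (excursion-cost (cost tr) (position tr) (start G v) (deg G v)
                                          (cost-bound inv) (base≤tapeSize inv) (listEnd≤tapeSize v))
    ; pending-bound = pending-visit {f = f} v fv
                        (subst (_≤ visitedSum f (deg G)) (+-suc V (length st)) (pending-bound inv))
    ; excursions-bound = excursions-visit {f = f} v fv (excursions-bound inv)
    }

  visit-root : ∀ {b V f tr u} → f u ≡ true → b ≤ start G u → Invariant b V f [] tr →
               Invariant (listEnd u) V (setFree f u false) (pushFree (setFree f u false) (G u) []) (tr ++ listAddrs G u)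
  visit-root {b} {V} {f} {tr} {u} fu b≤u inv = record
    { base≤tapeSize = listEnd≤tapeSize u
    ; cost-bound = subst₂ (λ c p → c + ∣ p - listEnd u ∣ ≤ listEnd u + 3 * tapeSize * V)
                          (sym (read-cost tr u)) (sym (read-position tr u))
                          (rebase-cost (cost tr) (position tr) (start G u) (deg G u) (cost-bound inv) b≤u)
    ; pending-bound = pending-visit {f = f} u fu (pending-bound inv)
    ; excursions-bound = ≤-trans (n≤1+n V) (excursions-visit {f = f} u fu (excursions-bound inv))
    }

  Settled : ℕ → (Fin n → Bool) × List ℕ → Set
  Settled b state = ∃[ V ] Invariant b V (proj₁ state) [] (proj₂ state)

  whileLoop-settled : ∀ k {b V f st tr} → Invariant b V f st tr → Settled b (whileLoop G k f st tr)
  whileLoop-settled zero inv = _ , shrink-stack z≤n inv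
  whileLoop-settled (suc k) {st = []} inv = _ , inv
  whileLoop-settled (suc k) {f = f} {st = v ∷ st} inv with f v in fv
  ... | false = whileLoop-settled k (shrink-stack (n≤1+n _) inv)
  ... | true = whileLoop-settled k (visit-excursion fv inv)

  root-settled : ∀ {b V f tr} u → b ≤ start G u → Invariant b V f [] tr →
                 Settled b (whileLoop G (fuel G) f [ u ] tr) ⊎ Settled (listEnd u) (whileLoop G (fuel G) f [ u ] tr)
  root-settled {f = f} u b≤u inv with f u in fu
  ... | false = inj₁ (whileLoop-settled (n + numEdges G) inv)
  ... | true = inj₂ (whileLoop-settled (n + numEdges G) (visit-root fu b≤u inv))

  outerLoop-settled : ∀ us {b V f tr} → All (λ w → b ≤ start G w) us →
                      AllPairs (λ u w → listEnd u ≤ start G w) us → Invariant b V f [] tr → ∃[ b ] ∃[ f′ ] Settled b (f′ , outerLoop G us f tr)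
  outerLoop-settled [] _ _ inv = _ , _ , _ , inv
  outerLoop-settled (u ∷ us) {f = f} {tr} (b≤u ∷ b≤us) (u≤us ∷ sorted) inv
    with whileLoop G (fuel G) f [ u ] tr | root-settled u b≤u inv
  ... | _ | inj₁ (_ , inv′) = outerLoop-settled us b≤us sorted inv′
  ... | _ | inj₂ (_ , inv′) = outerLoop-settled us u≤us sorted inv′

  externalCost-bound : ∃[ V ] (externalCost G ≤ tapeSize + 3 * tapeSize * V × V ≤ n × V ≤ numEdges G)
  externalCost-bound
    with outerLoop-settled (allFin n) (All.universal (λ _ → z≤n) _) listsInOrder invariant-initially
  ... | _ , f , V , inv = V , cost≤ , V≤n , V≤E
    where
    cost≤ : externalCost G ≤ tapeSize + 3 * tapeSize * V
    cost≤ = ≤-trans (m+n≤o⇒m≤o _ (cost-bound inv)) (+-monoˡ-≤ _ (base≤tapeSize inv))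
    V≤n : V ≤ n
    V≤n = ≤-trans (excursions-bound inv) (visitedCount≤ f)
    V≤E : V ≤ numEdges G
    V≤E = ≤-trans (m≤m+n V 0) (≤-trans (pending-bound inv)
            (≤-trans (visitedSum≤sum f (deg G)) (≤-reflexive (sym numEdges≡sum))))

theorem7 : ∃[ c ] ((n : ℕ) → (G : Graph n) → 1 ≤ numEdges G →
             externalCost G ≤ c * n * numEdges G)
theorem7 = 8 , bound
  where
  bound : (n : ℕ) (G : Graph n) → 1 ≤ numEdges G → externalCost G ≤ 8 * n * numEdges G
  bound zero G ()
  bound (suc m) G 1≤E with DFSCost.externalCost-bound G
  ... | V , cost≤ , V≤n , V≤E = ≤-trans cost≤
          (subst (λ T → T + 3 * T * V ≤ 8 * suc m * numEdges G) (sym (DFSCost.tapeSize≡n+numEdges G))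
                 (n+E+3[n+E]V≤8nE V≤n V≤E (s≤s z≤n) 1≤E))
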